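{- For every integer $n\ge3$ there exists an irreducible $\lambda$-quiddity of size $n$ over the ring $\mathbb{Z}\times\mathbb{Z}$.
   Context: For a commutative unital ring $A$ and $a_1,\ldots,a_n\in A$, set $M_n(a_1,\ldots,a_n)=\begin{pmatrix}a_n&-1\\1&0\end{pmatrix}\cdots\begin{pmatrix}a_1&-1\\1&0\end{pmatrix}$. An $n$-tuple $(a_1,\ldots,a_n)\in A^n$ is a $\lambda$-quiddity over $A$ of size $n$ if $M_n(a_1,\ldots,a_n)=\pm Id$. For $(a_1,\ldots,a_n)\in A^n$, $(b_1,\ldots,b_m)\in A^m$ define $(a_1,\ldots,a_n)\oplus(b_1,\ldots,b_m)=(a_1+b_m,a_2,\ldots,a_{n-1},a_n+b_1,b_2,\ldots,b_{m-1})$. Write $(a_1,\ldots,a_n)\sim(b_1,\ldots,b_n)$ if $(b_1,\ldots,b_n)$ is obtained by a cyclic permutation of $(a_1,\ldots,a_n)$ or of $(a_n,\ldots,a_1)$. A $\lambda$-quiddity $(c_1,\ldots,c_n)$ with $n\ge3$ is reducible if there exist a $\lambda$-quiddity $(b_1,\ldots,b_l)$ and $(a_1,\ldots,a_m)\in A^m$ with $m,l\ge3$ and $(c_1,\ldots,c_n)\sim(a_1,\ldots,a_m)\oplus(b_1,\ldots,b_l)$; otherwise it is irreducible. -}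

module Defs where

open import Data.Nat using (ℕ; _<_; _≥_)
open import Data.Integer as ℤ using (ℤ)
open import Data.Product using (_×_; _,_; proj₁; proj₂; ∃; ∃-syntax)
open import Data.Sum using (_⊎_)
open import Data.List using (List; []; _∷_; _++_; length; reverse; take; drop)
open import Relation.Binary.PropositionalEquality using (_≡_)
open import Relation.Nullary using (¬_)

A : Set
A = ℤ × ℤ

infixl 6 _+A_
infixl 7 _*A_

_+A_ : A → A → A
(a , b) +A (c , d) = (a ℤ.+ c , b ℤ.+ d)

_*A_ : A → A → A
(a , b) *A (c , d) = (a ℤ.* c , b ℤ.* d)

-A_ : A → A
-A (a , b) = (ℤ.- a , ℤ.- b)

0A 1A : A
0A = (ℤ.0ℤ , ℤ.0ℤ)
1A = (ℤ.1ℤ , ℤ.1ℤ)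

record Mat2 : Set where
  constructor mat
  field
    m11 m12 m21 m22 : A

open Mat2 public

_⊗_ : Mat2 → Mat2 → Mat2
mat a b c d ⊗ mat e f g h =
  mat (a *A e +A b *A g) (a *A f +A b *A h)
      (c *A e +A d *A g) (c *A f +A d *A h)

Id : Mat2
Id = mat 1A 0A 0A 1A

-Id : Mat2
-Id = mat (-A 1A) 0A 0A (-A 1A)

elemM : A → Mat2
elemM a = mat a (-A 1A) 1A 0A

-- M_n(a_1,…,a_n) = elemM a_n ⊗ ⋯ ⊗ elemM a_1
Mfrom : Mat2 → List A → Mat2
Mfrom acc []       = acc
Mfrom acc (a ∷ as) = Mfrom (elemM a ⊗ acc) as

M : List A → Mat2
M = Mfrom Id

IsλQuiddity : List A → Set
IsλQuiddity c = M c ≡ Id ⊎ M c ≡ -Id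

IsλQuiddityOfSize : ℕ → List A → Set
IsλQuiddityOfSize n c = length c ≡ n × IsλQuiddity c

splitLast : A → List A → List A × A
splitLast x []       = ([] , x)
splitLast x (y ∷ ys) = (x ∷ proj₁ (splitLast y ys) , proj₂ (splitLast y ys))

-- (a_1,…,a_n) ⊕ (b_1,…,b_m)
--   = (a_1 + b_m, a_2, …, a_{n-1}, a_n + b_1, b_2, …, b_{m-1})
_⊕_ : List A → List A → List A
(a₁ ∷ a₂ ∷ as) ⊕ (b₁ ∷ b₂ ∷ bs) =
  (a₁ +A proj₂ (splitLast b₂ bs))
    ∷ (proj₁ (splitLast a₂ as)
        ++ ((proj₂ (splitLast a₂ as) +A b₁) ∷ proj₁ (splitLast b₂ bs)))
_ ⊕ _ = []   -- junk value; only used for lengths ≥ 3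

rotate : ℕ → List A → List A
rotate k xs = drop k xs ++ take k xs

_∼_ : List A → List A → Set
a ∼ b = ∃[ k ] (k < length a × (b ≡ rotate k a ⊎ b ≡ rotate k (reverse a)))

Reducible : List A → Set
Reducible c =
  ∃[ a ] ∃[ b ] (length a ≥ 3 × length b ≥ 3 × IsλQuiddity b × c ∼ (a ⊕ b))

Irreducible : List A → Set
Irreducible c = IsλQuiddity c × length c ≥ 3 × ¬ Reducible c

-- Both coordinates of the witness c = adjacentFans m are quiddities of the same (m+4)-gon, triangulated
-- by the diagonals through one vertex, for two adjacent choices of that vertex; hence M c = -Id.
-- If c ∼ a ⊕ b with b a λ-quiddity, then the interior w of b (b without its first and last entry)
-- is a cyclic window of c of length between 1 and n - 3, and the entry (2,2) of M b is minus the
-- continuant of w, so that continuant is ±(1 , 1). In a fan triangulation the continuant of a short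
-- window is at least 2 unless the window is adjacent to the centre of the fan; no short window is
-- adjacent to both centres, so every short window of c has a coordinate of continuant at least 2.
-- For n = 3, the λ-quiddity (1,1,1) has no short window at all.
module Submission where

open import Defs
open import Data.Nat as ℕ using (ℕ; zero; suc; _≥_; s≤s; z≤n)
import Data.Nat.Properties as ℕP
import Data.Nat.Tactic.RingSolver as ℕ-Ring
open import Data.Integer as ℤ using (ℤ; +_; +≤+)
import Data.Integer.Properties as ℤP
open import Data.Integer.Tactic.RingSolver using (solve-∀)
open import Data.Integer.Solver using (module +-*-Solver)
open import Data.Product using (_×_; _,_; proj₁; proj₂; ∃-syntax)
open import Data.Sum using (_⊎_; inj₁; inj₂)
open import Data.List using (List; []; _∷_; _++_; [_]; length; reverse; take; drop; replicate; map; foldl)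
import Data.List.Properties as List
open import Function using (flip)
open import Relation.Binary.PropositionalEquality hiding ([_])
open import Relation.Nullary using (¬_)

-- Multiplication of a column by the matrix ( a -1 ; 1 0 ), over any carrier so that the ring
-- solver can also evaluate it on symbolic expressions.
module Step {R : Set} (_·_ _−_ : R → R → R) where
  step : R → R × R → R × R
  step a (p , q) = ((a · p) − q , p)

open Step ℤ._*_ ℤ._-_

run : List ℤ → ℤ × ℤ → ℤ × ℤ
run w s = foldl (flip step) s w

-- The columns of the product of the matrices of the entries of w; col₁ w consists of the
-- continuant of w and that of w without its last entry.
col₁ col₂ : List ℤ → ℤ × ℤ
col₁ w = run w (+ 1 , + 0)
col₂ w = run w (+ 0 , + 1)

continuant : List ℤ → ℤ
continuant w = proj₁ (col₁ w)

neg : ℤ × ℤ → ℤ × ℤ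
neg (p , q) = (ℤ.- p , ℤ.- q)

combine : ℤ → ℤ × ℤ → ℤ → ℤ × ℤ → ℤ × ℤ
combine p (x , y) q (z , t) = (p ℤ.* x ℤ.+ q ℤ.* z , p ℤ.* y ℤ.+ q ℤ.* t)

run-++ : ∀ xs ys s → run (xs ++ ys) s ≡ run ys (run xs s)
run-++ xs ys s = List.foldl-++ (flip step) s xs ys

run-neg : ∀ w s → run w (neg s) ≡ neg (run w s)
run-neg []      s       = refl
run-neg (a ∷ w) (p , q) = trans (cong (λ x → run w (x , ℤ.- p)) (identity a p q)) (run-neg w (step a (p , q)))
  where
  identity : ∀ a p q → a ℤ.* ℤ.- p ℤ.- ℤ.- q ≡ ℤ.- (a ℤ.* p ℤ.- q)
  identity = solve-∀

run-linear : ∀ w p q → run w (p , q) ≡ combine p (col₁ w) q (col₂ w)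
run-linear []      p q = cong₂ _,_ (unit₁ p q) (unit₂ p q)
  where
  unit₁ : ∀ p q → p ≡ p ℤ.* + 1 ℤ.+ q ℤ.* + 0
  unit₁ = solve-∀
  unit₂ : ∀ p q → q ≡ p ℤ.* + 0 ℤ.+ q ℤ.* + 1
  unit₂ = solve-∀
run-linear (a ∷ w) p q = begin
  run w (a ℤ.* p ℤ.- q , p)                    ≡⟨ run-linear w _ _ ⟩
  combine (a ℤ.* p ℤ.- q) (col₁ w) p (col₂ w)  ≡⟨ combine-step (col₁ w) (col₂ w) ⟩
  combine p (combine (a ℤ.* + 1 ℤ.- + 0) (col₁ w) (+ 1) (col₂ w))
          q (combine (a ℤ.* + 0 ℤ.- + 1) (col₁ w) (+ 0) (col₂ w))
    ≡⟨ sym (cong₂ (λ u v → combine p u q v) (run-linear w _ _) (run-linear w _ _)) ⟩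
  combine p (col₁ (a ∷ w)) q (col₂ (a ∷ w))    ∎
  where
  open ≡-Reasoning
  expand : ∀ a p q x z → (a ℤ.* p ℤ.- q) ℤ.* x ℤ.+ p ℤ.* z
         ≡ p ℤ.* ((a ℤ.* + 1 ℤ.- + 0) ℤ.* x ℤ.+ + 1 ℤ.* z) ℤ.+ q ℤ.* ((a ℤ.* + 0 ℤ.- + 1) ℤ.* x ℤ.+ + 0 ℤ.* z)
  expand = solve-∀
  combine-step : ∀ u v → combine (a ℤ.* p ℤ.- q) u p v
               ≡ combine p (combine (a ℤ.* + 1 ℤ.- + 0) u (+ 1) v) q (combine (a ℤ.* + 0 ℤ.- + 1) u (+ 0) v)
  combine-step (x , y) (z , t) = cong₂ _,_ (expand a p q x z) (expand a p q y t)

col₁-∷ : ∀ a w → col₁ (a ∷ w) ≡ combine a (col₁ w) (+ 1) (col₂ w)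
col₁-∷ a w = trans (cong (λ x → run w (x , + 1)) (identity a)) (run-linear w a (+ 1))
  where
  identity : ∀ a → a ℤ.* + 1 ℤ.- + 0 ≡ a
  identity = solve-∀

col₂-∷ : ∀ a w → col₂ (a ∷ w) ≡ neg (col₁ w)
col₂-∷ a w = trans (cong (λ x → run w (x , + 0)) (identity a)) (run-neg w (+ 1 , + 0))
  where
  identity : ∀ a → a ℤ.* + 0 ℤ.- + 1 ≡ ℤ.- + 1
  identity = solve-∀

col₂-interior : ∀ a w z → proj₂ (col₂ (a ∷ w ++ [ z ])) ≡ ℤ.- continuant w
col₂-interior a w z = trans (cong proj₂ (run-++ w [ z ] _)) (cong proj₁ (col₂-∷ a w))

run-reverse-∷ : ∀ a w s → run (reverse (a ∷ w)) s ≡ step a (run (reverse w) s)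
run-reverse-∷ a w s = trans (cong (λ v → run v s) (List.unfold-reverse a w)) (run-++ (reverse w) [ a ] s)

-- The matrix of reverse w is the transpose of that of w, conjugated by diag(1, -1).
transpose-reverse : ∀ w → col₁ (reverse w) ≡ (proj₁ (col₁ w) , ℤ.- proj₁ (col₂ w))
                        × col₂ (reverse w) ≡ (ℤ.- proj₂ (col₁ w) , proj₂ (col₂ w))
transpose-reverse []      = refl , refl
transpose-reverse (a ∷ w) =
  (begin
    col₁ (reverse (a ∷ w))                            ≡⟨ run-reverse-∷ a w _ ⟩
    step a (col₁ (reverse w))                         ≡⟨ cong (step a) (proj₁ (transpose-reverse w)) ⟩
    (a ℤ.* x ℤ.- ℤ.- z , x)                           ≡⟨ cong₂ _,_ (expand a x z) (sym (ℤP.neg-involutive x)) ⟩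
    (proj₁ (combine a c (+ 1) d) , ℤ.- proj₁ (neg c)) ≡⟨ cong₂ (λ u v → (proj₁ u , ℤ.- proj₁ v)) (sym (col₁-∷ a w)) (sym (col₂-∷ a w)) ⟩
    (proj₁ (col₁ (a ∷ w)) , ℤ.- proj₁ (col₂ (a ∷ w))) ∎)
  , (begin
    col₂ (reverse (a ∷ w))                            ≡⟨ run-reverse-∷ a w _ ⟩
    step a (col₂ (reverse w))                         ≡⟨ cong (step a) (proj₂ (transpose-reverse w)) ⟩
    (a ℤ.* ℤ.- y ℤ.- t , ℤ.- y)                       ≡⟨ cong (_, ℤ.- y) (expand′ a y t) ⟩
    (ℤ.- proj₂ (combine a c (+ 1) d) , proj₂ (neg c)) ≡⟨ cong₂ (λ u v → (ℤ.- proj₂ u , proj₂ v)) (sym (col₁-∷ a w)) (sym (col₂-∷ a w)) ⟩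
    (ℤ.- proj₂ (col₁ (a ∷ w)) , proj₂ (col₂ (a ∷ w))) ∎)
  where
  open ≡-Reasoning
  c = col₁ w
  d = col₂ w
  x = proj₁ c
  y = proj₂ c
  z = proj₁ d
  t = proj₂ d
  expand : ∀ a x z → a ℤ.* x ℤ.- ℤ.- z ≡ a ℤ.* x ℤ.+ + 1 ℤ.* z
  expand = solve-∀
  expand′ : ∀ a y t → a ℤ.* ℤ.- y ℤ.- t ≡ ℤ.- (a ℤ.* y ℤ.+ + 1 ℤ.* t)
  expand′ = solve-∀

continuant-reverse : ∀ w → continuant (reverse w) ≡ continuant w
continuant-reverse w = cong proj₁ (proj₁ (transpose-reverse w))

run-twos : ∀ t p q → run (replicate t (+ 2)) (p , q) ≡ (p ℤ.+ + t ℤ.* (p ℤ.- q) , q ℤ.+ + t ℤ.* (p ℤ.- q))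
run-twos zero    p q = cong₂ _,_ (no-twos p q) (no-twos q p)
  where
  no-twos : ∀ p q → p ≡ p ℤ.+ + 0 ℤ.* (q ℤ.- p)
  no-twos = solve-∀
run-twos (suc t) p q = trans (run-twos t _ _) (cong₂ _,_ (one-more p q (+ t)) (one-more′ p q (+ t)))
  where
  one-more : ∀ p q t → (+ 2 ℤ.* p ℤ.- q) ℤ.+ t ℤ.* ((+ 2 ℤ.* p ℤ.- q) ℤ.- p) ≡ p ℤ.+ (+ 1 ℤ.+ t) ℤ.* (p ℤ.- q)
  one-more = solve-∀
  one-more′ : ∀ p q t → p ℤ.+ t ℤ.* ((+ 2 ℤ.* p ℤ.- q) ℤ.- p) ≡ q ℤ.+ (+ 1 ℤ.+ t) ℤ.* (p ℤ.- q)
  one-more′ = solve-∀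

record IsRingHom (π : A → ℤ) : Set where
  field
    +-hom : ∀ x y → π (x +A y) ≡ π x ℤ.+ π y
    *-hom : ∀ x y → π (x *A y) ≡ π x ℤ.* π y
    -‿hom : ∀ x → π (-A x) ≡ ℤ.- π x
    0-hom : π 0A ≡ + 0
    1-hom : π 1A ≡ + 1

proj₁-isRingHom : IsRingHom proj₁
proj₁-isRingHom = record
  { +-hom = λ _ _ → refl ; *-hom = λ _ _ → refl ; -‿hom = λ _ → refl ; 0-hom = refl ; 1-hom = refl }

proj₂-isRingHom : IsRingHom proj₂
proj₂-isRingHom = record
  { +-hom = λ _ _ → refl ; *-hom = λ _ _ → refl ; -‿hom = λ _ → refl ; 0-hom = refl ; 1-hom = refl }

module Coordinate {π : A → ℤ} (hom : IsRingHom π) where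
  open IsRingHom hom

  column₁ column₂ : Mat2 → ℤ × ℤ
  column₁ R = (π (m11 R) , π (m21 R))
  column₂ R = (π (m12 R) , π (m22 R))

  elemM-column : ∀ x u v → (π (x *A u +A (-A 1A) *A v) , π (1A *A u +A 0A *A v)) ≡ step (π x) (π u , π v)
  elemM-column x u v = cong₂ _,_ top bottom
    where
    top : π (x *A u +A (-A 1A) *A v) ≡ π x ℤ.* π u ℤ.- π v
    top = begin
      π (x *A u +A (-A 1A) *A v)          ≡⟨ trans (+-hom _ _) (cong₂ ℤ._+_ (*-hom x u) (*-hom (-A 1A) v)) ⟩
      π x ℤ.* π u ℤ.+ π (-A 1A) ℤ.* π v   ≡⟨ cong (λ k → π x ℤ.* π u ℤ.+ k ℤ.* π v) (trans (-‿hom 1A) (cong ℤ.-_ 1-hom)) ⟩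
      π x ℤ.* π u ℤ.+ ℤ.- + 1 ℤ.* π v     ≡⟨ identity (π x) (π u) (π v) ⟩
      π x ℤ.* π u ℤ.- π v                 ∎
      where
      open ≡-Reasoning
      identity : ∀ x u v → x ℤ.* u ℤ.+ ℤ.- + 1 ℤ.* v ≡ x ℤ.* u ℤ.- v
      identity = solve-∀
    bottom : π (1A *A u +A 0A *A v) ≡ π u
    bottom = begin
      π (1A *A u +A 0A *A v)          ≡⟨ trans (+-hom _ _) (cong₂ ℤ._+_ (*-hom 1A u) (*-hom 0A v)) ⟩
      π 1A ℤ.* π u ℤ.+ π 0A ℤ.* π v   ≡⟨ cong₂ (λ k l → k ℤ.* π u ℤ.+ l ℤ.* π v) 1-hom 0-hom ⟩
      + 1 ℤ.* π u ℤ.+ + 0 ℤ.* π v     ≡⟨ identity (π u) (π v) ⟩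
      π u                             ∎
      where
      open ≡-Reasoning
      identity : ∀ u v → + 1 ℤ.* u ℤ.+ + 0 ℤ.* v ≡ u
      identity = solve-∀

  column₁-Mfrom : ∀ c R → column₁ (Mfrom R c) ≡ run (map π c) (column₁ R)
  column₁-Mfrom []      R = refl
  column₁-Mfrom (x ∷ c) R =
    trans (column₁-Mfrom c (elemM x ⊗ R)) (cong (run (map π c)) (elemM-column x (m11 R) (m21 R)))

  column₂-Mfrom : ∀ c R → column₂ (Mfrom R c) ≡ run (map π c) (column₂ R)
  column₂-Mfrom []      R = refl
  column₂-Mfrom (x ∷ c) R =
    trans (column₂-Mfrom c (elemM x ⊗ R)) (cong (run (map π c)) (elemM-column x (m12 R) (m22 R)))

  column₁-M : ∀ c → column₁ (M c) ≡ col₁ (map π c)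
  column₁-M c = trans (column₁-Mfrom c Id) (cong (run (map π c)) (cong₂ _,_ 1-hom 0-hom))

  column₂-M : ∀ c → column₂ (M c) ≡ col₂ (map π c)
  column₂-M c = trans (column₂-Mfrom c Id) (cong (run (map π c)) (cong₂ _,_ 0-hom 1-hom))

  continuant-interior : ∀ b w b′ {R} → M (b ∷ w ++ [ b′ ]) ≡ R → continuant (map π w) ≡ ℤ.- π (m22 R)
  continuant-interior b w b′ refl = begin
    continuant (map π w)                            ≡⟨ sym (ℤP.neg-involutive _) ⟩
    ℤ.- ℤ.- continuant (map π w)                    ≡⟨ cong ℤ.-_ (sym (col₂-interior (π b) (map π w) (π b′))) ⟩
    ℤ.- proj₂ (col₂ (π b ∷ map π w ++ [ π b′ ]))    ≡⟨ cong (λ v → ℤ.- proj₂ (col₂ (π b ∷ v))) (sym (List.map-++ π w [ b′ ])) ⟩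
    ℤ.- proj₂ (col₂ (map π (b ∷ w ++ [ b′ ])))      ≡⟨ cong (λ k → ℤ.- proj₂ k) (sym (column₂-M (b ∷ w ++ [ b′ ]))) ⟩
    ℤ.- π (m22 (M (b ∷ w ++ [ b′ ])))               ∎
    where open ≡-Reasoning

module C₁ = Coordinate proj₁-isRingHom
module C₂ = Coordinate proj₂-isRingHom

continuantA : List A → A
continuantA w = (continuant (map proj₁ w) , continuant (map proj₂ w))

continuantA-reverse : ∀ w → continuantA (reverse w) ≡ continuantA w
continuantA-reverse w = cong₂ _,_ (reversed proj₁) (reversed proj₂)
  where
  reversed : ∀ π → continuant (map π (reverse w)) ≡ continuant (map π w)
  reversed π = trans (cong continuant (List.reverse-map π w)) (continuant-reverse (map π w))

interior-continuant : ∀ b w b′ → IsλQuiddity (b ∷ w ++ [ b′ ]) → continuantA w ≡ -A 1A ⊎ continuantA w ≡ 1A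
interior-continuant b w b′ (inj₁ M≡Id)  = inj₁ (cong₂ _,_ (C₁.continuant-interior b w b′ M≡Id) (C₂.continuant-interior b w b′ M≡Id))
interior-continuant b w b′ (inj₂ M≡-Id) = inj₂ (cong₂ _,_ (C₁.continuant-interior b w b′ M≡-Id) (C₂.continuant-interior b w b′ M≡-Id))

M-≡-−Id : ∀ c → (∀ s → run (map proj₁ c) s ≡ neg s) → (∀ s → run (map proj₂ c) s ≡ neg s) → M c ≡ -Id
M-≡-−Id c first second = from-columns
  (trans (C₁.column₁-M c) (first _)) (trans (C₁.column₂-M c) (first _))
  (trans (C₂.column₁-M c) (second _)) (trans (C₂.column₂-M c) (second _))
  where
  from-columns : ∀ {R} → C₁.column₁ R ≡ (ℤ.- + 1 , + 0) → C₁.column₂ R ≡ (+ 0 , ℤ.- + 1)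
               → C₂.column₁ R ≡ (ℤ.- + 1 , + 0) → C₂.column₂ R ≡ (+ 0 , ℤ.- + 1) → R ≡ -Id
  from-columns refl refl refl refl = refl

two : A
two = (+ 2 , + 2)

adjacentFans : ℕ → List A
adjacentFans m = (+ 1 , + 2) ∷ (+ (2 ℕ.+ m) , + 1) ∷ (+ 1 , + (2 ℕ.+ m)) ∷ (+ 2 , + 1) ∷ replicate m two

length-adjacentFans : ∀ m → length (adjacentFans m) ≡ 4 ℕ.+ m
length-adjacentFans m = cong (4 ℕ.+_) (List.length-replicate m)

module _ where
  open +-*-Solver

  symbolicStep : ∀ {n} → Polynomial n → Polynomial n × Polynomial n → Polynomial n × Polynomial n
  symbolicStep {n} = Step.step (_:*_ {n}) (_:-_ {n})

  run-fan₁ : ∀ m s → run (map proj₁ (adjacentFans m)) s ≡ neg s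
  run-fan₁ m (p , q) =
    trans (cong (λ w → run w (step (+ 2) (step (+ 1) (step (+ (2 ℕ.+ m)) (step (+ 1) (p , q))))))
                (List.map-replicate proj₁ m two))
    (trans (run-twos m _ _)
      (cong₂ _,_ (solve 3 (λ P Q m′ → let s = afterHead P Q m′ in proj₁ s :+ m′ :* (proj₁ s :- proj₂ s) := :- P) refl p q (+ m))
                 (solve 3 (λ P Q m′ → let s = afterHead P Q m′ in proj₂ s :+ m′ :* (proj₁ s :- proj₂ s) := :- Q) refl p q (+ m))))
    where
    afterHead : ∀ {n} → Polynomial n → Polynomial n → Polynomial n → Polynomial n × Polynomial n
    afterHead P Q m′ = symbolicStep (con (+ 2)) (symbolicStep (con (+ 1)) (symbolicStep (con (+ 2) :+ m′) (symbolicStep (con (+ 1)) (P , Q))))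

  run-fan₂ : ∀ m s → run (map proj₂ (adjacentFans m)) s ≡ neg s
  run-fan₂ m (p , q) =
    trans (cong (λ w → run w (step (+ 1) (step (+ (2 ℕ.+ m)) (step (+ 1) (step (+ 2) (p , q))))))
                (List.map-replicate proj₂ m two))
    (trans (run-twos m _ _)
      (cong₂ _,_ (solve 3 (λ P Q m′ → let s = afterHead P Q m′ in proj₁ s :+ m′ :* (proj₁ s :- proj₂ s) := :- P) refl p q (+ m))
                 (solve 3 (λ P Q m′ → let s = afterHead P Q m′ in proj₂ s :+ m′ :* (proj₁ s :- proj₂ s) := :- Q) refl p q (+ m))))
    where
    afterHead : ∀ {n} → Polynomial n → Polynomial n → Polynomial n → Polynomial n × Polynomial n
    afterHead P Q m′ = symbolicStep (con (+ 1)) (symbolicStep (con (+ 2) :+ m′) (symbolicStep (con (+ 1)) (symbolicStep (con (+ 2)) (P , Q))))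

adjacentFans-quiddity : ∀ m → M (adjacentFans m) ≡ -Id
adjacentFans-quiddity m = M-≡-−Id (adjacentFans m) (run-fan₁ m) (run-fan₂ m)

Large : A → Set
Large k = + 2 ℤ.≤ proj₁ k ⊎ + 2 ℤ.≤ proj₂ k

large⇒≢±1 : ∀ {k} → Large k → ¬ (k ≡ -A 1A ⊎ k ≡ 1A)
large⇒≢±1 (inj₁ ())               (inj₁ refl)
large⇒≢±1 (inj₂ ())               (inj₁ refl)
large⇒≢±1 (inj₁ (+≤+ (s≤s ()))) (inj₂ refl)
large⇒≢±1 (inj₂ (+≤+ (s≤s ()))) (inj₂ refl)

CyclicWindow : List A → List A → Set
CyclicWindow c w = ∃[ P ] ∃[ Q ] (c ++ c ≡ P ++ w ++ Q)

ShortWindowsLarge : List A → Set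
ShortWindowsLarge c = ∀ w → CyclicWindow c w → 1 ℕ.≤ length w → 3 ℕ.+ length w ℕ.≤ length c → Large (continuantA w)

length-rotate : ∀ k c → length (rotate k c) ≡ length c
length-rotate k c = begin
  length (drop k c ++ take k c)           ≡⟨ List.length-++-comm (drop k c) (take k c) ⟩
  length (take k c ++ drop k c)           ≡⟨ cong length (List.take++drop≡id k c) ⟩
  length c                                ∎
  where open ≡-Reasoning

rotate-window : ∀ k c {U w} → rotate k c ≡ U ++ w → CyclicWindow c w
rotate-window k c {U} {w} e = take k c ++ U , drop k c , (begin
  c ++ c                  ≡⟨ sym (cong₂ _++_ (List.take++drop≡id k c) (List.take++drop≡id k c)) ⟩
  (t ++ d) ++ (t ++ d)    ≡⟨ List.++-assoc t d (t ++ d) ⟩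
  t ++ (d ++ t ++ d)      ≡⟨ cong (t ++_) (sym (List.++-assoc d t d)) ⟩
  t ++ ((d ++ t) ++ d)    ≡⟨ cong (λ v → t ++ (v ++ d)) e ⟩
  t ++ ((U ++ w) ++ d)    ≡⟨ cong (t ++_) (List.++-assoc U w d) ⟩
  t ++ (U ++ w ++ d)      ≡⟨ sym (List.++-assoc t U (w ++ d)) ⟩
  (t ++ U) ++ w ++ d      ∎)
  where
  open ≡-Reasoning
  t = take k c
  d = drop k c

reverse-window : ∀ c {w} → CyclicWindow (reverse c) w → CyclicWindow c (reverse w)
reverse-window c {w} (P , Q , e) = reverse Q , reverse P , (begin
  c ++ c                                 ≡⟨ sym (cong₂ _++_ (List.reverse-involutive c) (List.reverse-involutive c)) ⟩
  reverse (reverse c) ++ reverse (reverse c) ≡⟨ sym (List.reverse-++ (reverse c) (reverse c)) ⟩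
  reverse (reverse c ++ reverse c)       ≡⟨ cong reverse e ⟩
  reverse (P ++ w ++ Q)                  ≡⟨ List.reverse-++ P (w ++ Q) ⟩
  reverse (w ++ Q) ++ reverse P          ≡⟨ cong (_++ reverse P) (List.reverse-++ w Q) ⟩
  (reverse Q ++ reverse w) ++ reverse P  ≡⟨ List.++-assoc (reverse Q) (reverse w) (reverse P) ⟩
  reverse Q ++ reverse w ++ reverse P    ∎)
  where open ≡-Reasoning

splitLast-≡ : ∀ x xs → x ∷ xs ≡ proj₁ (splitLast x xs) ++ [ proj₂ (splitLast x xs) ]
splitLast-≡ x []       = refl
splitLast-≡ x (y ∷ ys) = cong (x ∷_) (splitLast-≡ y ys)

⊕-interior : ∀ a b → length a ≥ 3 → length b ≥ 3 →
  ∃[ b₁ ] ∃[ w ] ∃[ bₗ ] ∃[ U ] (b ≡ b₁ ∷ w ++ [ bₗ ] × a ⊕ b ≡ U ++ w × 3 ℕ.≤ length U × 1 ℕ.≤ length w)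
⊕-interior []                 _ () _
⊕-interior (_ ∷ [])           _ (s≤s ()) _
⊕-interior (_ ∷ _ ∷ [])       _ (s≤s (s≤s ())) _
⊕-interior (_ ∷ _ ∷ _ ∷ _) []                 _ ()
⊕-interior (_ ∷ _ ∷ _ ∷ _) (_ ∷ [])           _ (s≤s ())
⊕-interior (_ ∷ _ ∷ _ ∷ _) (_ ∷ _ ∷ [])       _ (s≤s (s≤s ()))
⊕-interior (a₁ ∷ a₂ ∷ a₃ ∷ as) (b₁ ∷ b₂ ∷ b₃ ∷ bs) _ _ =
  b₁ , w , bₗ , U , cong (b₁ ∷_) (splitLast-≡ b₂ (b₃ ∷ bs)) , cong (λ v → h ∷ a₂ ∷ v) (sym (List.++-assoc I [ x ] w))
     , s≤s (s≤s (List.length-++-≤ʳ [ x ] {I})) , s≤s z≤n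
  where
  w  = proj₁ (splitLast b₂ (b₃ ∷ bs))
  bₗ = proj₂ (splitLast b₂ (b₃ ∷ bs))
  I  = proj₁ (splitLast a₃ as)
  x  = proj₂ (splitLast a₂ (a₃ ∷ as)) +A b₁
  h  = a₁ +A bₗ
  U  = h ∷ a₂ ∷ I ++ [ x ]

short-windows⇒¬reducible : ∀ c → ShortWindowsLarge c → ¬ Reducible c
short-windows⇒¬reducible c large (a , b , 3≤a , 3≤b , b-quiddity , k , _ , c∼a⊕b) with ⊕-interior a b 3≤a 3≤b
... | b₁ , w , bₗ , U , refl , a⊕b≡ , 3≤U , 1≤w =
  large⇒≢±1 (interior-large c∼a⊕b) (interior-continuant b₁ w bₗ b-quiddity)
  where
  short : ∀ {xs} → rotate k xs ≡ U ++ w → 3 ℕ.+ length w ℕ.≤ length xs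
  short {xs} e = ℕP.≤-trans (ℕP.+-monoˡ-≤ (length w) 3≤U)
    (ℕP.≤-reflexive (trans (sym (List.length-++ U)) (trans (cong length (sym e)) (length-rotate k xs))))
  interior-large : (a ⊕ _ ≡ rotate k c) ⊎ (a ⊕ _ ≡ rotate k (reverse c)) → Large (continuantA w)
  interior-large (inj₁ e) = large w (rotate-window k c e′) 1≤w (short e′)
    where e′ = trans (sym e) a⊕b≡
  interior-large (inj₂ e) = subst Large (continuantA-reverse w)
    (large (reverse w) (reverse-window c {w} (rotate-window k (reverse c) {U} {w} e′))
       (subst (1 ℕ.≤_) (sym (List.length-reverse w)) 1≤w)
       (subst₂ (λ l l′ → 3 ℕ.+ l ℕ.≤ l′) (sym (List.length-reverse w)) (List.length-reverse c) (short e′)))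
    where e′ = trans (sym e) a⊕b≡

data AllShortPrefixes {L S : Set} (act : L → S → S) (P : S → Set) : ℕ → S → List L → Set where
  stop : ∀ {s zs} → AllShortPrefixes act P zero s zs
  end  : ∀ {b s} → AllShortPrefixes act P b s []
  _∷_  : ∀ {b s z zs} → P (act z s) → AllShortPrefixes act P b (act z s) zs → AllShortPrefixes act P (suc b) s (z ∷ zs)

module _ {L S : Set} {act : L → S → S} {P : S → Set} where

  step-to : ∀ {b s s′ z zs} → act z s ≡ s′ → P s′ → AllShortPrefixes act P b s′ zs → AllShortPrefixes act P (suc b) s (z ∷ zs)
  step-to refl p ps = p ∷ ps

  prefixes-++ : ∀ {k b s} x {y} → length x ≡ k → AllShortPrefixes act P k s x
              → AllShortPrefixes act P b (foldl (flip act) s x) y → AllShortPrefixes act P (k ℕ.+ b) s (x ++ y)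
  prefixes-++ []      refl _        qs = qs
  prefixes-++ (_ ∷ x) refl (p ∷ ps) qs = p ∷ prefixes-++ x refl ps qs

  prefixes-extend : ∀ {b s} x {y} → b ℕ.≤ length x → AllShortPrefixes act P b s x → AllShortPrefixes act P b s (x ++ y)
  prefixes-extend _       _         stop     = stop
  prefixes-extend []      z≤n       end      = stop
  prefixes-extend (_ ∷ x) (s≤s b≤x) (p ∷ ps) = p ∷ prefixes-extend x b≤x ps

  prefixes-at : ∀ {b s} v {R} → AllShortPrefixes act P b s (v ++ R) → 1 ℕ.≤ length v → length v ℕ.≤ b
              → P (foldl (flip act) s v)
  prefixes-at []          _        ()       _
  prefixes-at (_ ∷ _)     stop     _        ()
  prefixes-at (_ ∷ [])    (p ∷ _)  _        _         = p
  prefixes-at (_ ∷ z ∷ v) (_ ∷ ps) _        (s≤s v≤b) = prefixes-at (z ∷ v) ps (s≤s z≤n) v≤b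

Prefixes≥2 : ℕ → ℤ × ℤ → List ℤ → Set
Prefixes≥2 = AllShortPrefixes step (λ s → + 2 ℤ.≤ proj₁ s)

step₂ : A → (ℤ × ℤ) × (ℤ × ℤ) → (ℤ × ℤ) × (ℤ × ℤ)
step₂ (a₁ , a₂) (s₁ , s₂) = (step a₁ s₁ , step a₂ s₂)

heads : (ℤ × ℤ) × (ℤ × ℤ) → A
heads ((p₁ , _) , (p₂ , _)) = (p₁ , p₂)

start : (ℤ × ℤ) × (ℤ × ℤ)
start = ((+ 1 , + 0) , (+ 1 , + 0))

PrefixesLarge : ℕ → (ℤ × ℤ) × (ℤ × ℤ) → List A → Set
PrefixesLarge = AllShortPrefixes step₂ (λ s → Large (heads s))

run₂ : List A → (ℤ × ℤ) × (ℤ × ℤ) → (ℤ × ℤ) × (ℤ × ℤ)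
run₂ w s = foldl (flip step₂) s w

run₂-coordinates : ∀ w s₁ s₂ → run₂ w (s₁ , s₂) ≡ (run (map proj₁ w) s₁ , run (map proj₂ w) s₂)
run₂-coordinates []      s₁ s₂ = refl
run₂-coordinates (a ∷ w) s₁ s₂ = run₂-coordinates w (step (proj₁ a) s₁) (step (proj₂ a) s₂)

via-first : ∀ {b s₁ s₂} z → Prefixes≥2 b s₁ (map proj₁ z) → PrefixesLarge b (s₁ , s₂) z
via-first []      _        = end
via-first (_ ∷ _) stop     = stop
via-first (_ ∷ z) (p ∷ ps) = inj₁ p ∷ via-first z ps

via-second : ∀ {b s₁ s₂} z → Prefixes≥2 b s₂ (map proj₂ z) → PrefixesLarge b (s₁ , s₂) z
via-second []      _        = end
via-second (_ ∷ _) stop     = stop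
via-second (_ ∷ z) (p ∷ ps) = inj₂ p ∷ via-second z ps

step-ℕ : ∀ a {p q r} → a ℕ.* p ≡ r ℕ.+ q → step (+ a) (+ p , + q) ≡ (+ r , + p)
step-ℕ a {p} {q} {r} e = cong (_, + p) (begin
  + a ℤ.* + p ℤ.- + q     ≡⟨ cong (ℤ._- + q) (sym (ℤP.pos-* a p)) ⟩
  + (a ℕ.* p) ℤ.- + q     ≡⟨ cong (λ k → + k ℤ.- + q) e ⟩
  + r ℤ.+ + q ℤ.- + q     ≡⟨ cancel (+ r) (+ q) ⟩
  + r                     ∎)
  where
  open ≡-Reasoning
  cancel : ∀ r q → r ℤ.+ q ℤ.- q ≡ r
  cancel = solve-∀

two≤ : ∀ n → + 2 ℤ.≤ + (2 ℕ.+ n)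
two≤ n = +≤+ (s≤s (s≤s z≤n))

twos-rising : ∀ t u → Prefixes≥2 t (+ suc u , + u) (replicate t (+ 2))
twos-rising zero    u = stop
twos-rising (suc t) u = step-to (step-ℕ 2 (rising u)) (two≤ u) (twos-rising t (suc u))
  where
  rising : ∀ u → 2 ℕ.* suc u ≡ (2 ℕ.+ u) ℕ.+ u
  rising = ℕ-Ring.solve-∀

twos-falling : ∀ b t → b ℕ.≤ t → Prefixes≥2 b (+ (2 ℕ.+ b) , + (3 ℕ.+ b)) (replicate t (+ 2))
twos-falling zero    _       _         = stop
twos-falling (suc b) (suc t) (s≤s b≤t) = step-to (step-ℕ 2 (falling b)) (two≤ b) (twos-falling b t b≤t)
  where
  falling : ∀ b → 2 ℕ.* (3 ℕ.+ b) ≡ (2 ℕ.+ b) ℕ.+ (4 ℕ.+ b)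
  falling = ℕ-Ring.solve-∀

-- (+ 1 , + q) is the state reached from (+ 1 , + 0) after q - 1 entries 2 and one entry 1.
centre-falling : ∀ {m} q d t → q ℕ.+ d ≡ m → d ℕ.≤ t
               → Prefixes≥2 (suc d) (+ 1 , + q) (+ (2 ℕ.+ m) ∷ + 1 ∷ replicate t (+ 2))
centre-falling q d t refl d≤t = step-to (step-ℕ (2 ℕ.+ (q ℕ.+ d)) (at-centre q d)) (two≤ d) (beyond d d≤t)
  where
  at-centre : ∀ q d → (2 ℕ.+ (q ℕ.+ d)) ℕ.* 1 ≡ (2 ℕ.+ d) ℕ.+ q
  at-centre = ℕ-Ring.solve-∀
  after-centre : ∀ d → 1 ℕ.* (3 ℕ.+ d) ≡ (2 ℕ.+ d) ℕ.+ 1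
  after-centre = ℕ-Ring.solve-∀
  beyond : ∀ d → d ℕ.≤ t → Prefixes≥2 d (+ (2 ℕ.+ d) , + 1) (+ 1 ∷ replicate t (+ 2))
  beyond zero    _   = stop
  beyond (suc d) d<t = step-to (step-ℕ 1 (after-centre d)) (two≤ d) (twos-falling d t (ℕP.<⇒≤ d<t))

run-twos-from-start : ∀ t → run (replicate t (+ 2)) (+ 1 , + 0) ≡ (+ suc t , + t)
run-twos-from-start t = trans (run-twos t _ _) (cong₂ _,_ (top (+ t)) (bottom (+ t)))
  where
  top : ∀ t → + 1 ℤ.+ t ℤ.* (+ 1 ℤ.- + 0) ≡ + 1 ℤ.+ t
  top = solve-∀
  bottom : ∀ t → + 0 ℤ.+ t ℤ.* (+ 1 ℤ.- + 0) ≡ t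
  bottom = solve-∀

run₂-twos : ∀ j → run₂ (replicate j two) start ≡ ((+ suc j , + j) , (+ suc j , + j))
run₂-twos j = trans (run₂-coordinates (replicate j two) _ _) (cong₂ _,_
  (trans (cong (λ w → run w (+ 1 , + 0)) (List.map-replicate proj₁ j two)) (run-twos-from-start j))
  (trans (cong (λ w → run w (+ 1 , + 0)) (List.map-replicate proj₂ j two)) (run-twos-from-start j)))

fans-after-twos : ∀ j i → PrefixesLarge (suc i) ((+ suc j , + j) , (+ suc j , + j)) (adjacentFans (j ℕ.+ i))
fans-after-twos j i = step-to (cong₂ _,_ (step-ℕ 1 (first j)) (step-ℕ 2 (second j))) (inj₂ (two≤ j)) (rest i)
  where
  first : ∀ j → 1 ℕ.* suc j ≡ 1 ℕ.+ j
  first = ℕ-Ring.solve-∀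
  second : ∀ j → 2 ℕ.* suc j ≡ (2 ℕ.+ j) ℕ.+ j
  second = ℕ-Ring.solve-∀
  rest : ∀ i → PrefixesLarge i ((+ 1 , + suc j) , (+ (2 ℕ.+ j) , + suc j)) (drop 1 (adjacentFans (j ℕ.+ i)))
  rest zero    = stop
  rest (suc d) = via-first _
    (subst (Prefixes≥2 (suc d) (+ 1 , + suc j))
           (cong (λ w → + (2 ℕ.+ (j ℕ.+ suc d)) ∷ + 1 ∷ + 2 ∷ w) (sym (List.map-replicate proj₁ (j ℕ.+ suc d) two)))
           (centre-falling (suc j) d (suc (j ℕ.+ suc d)) (sym (ℕP.+-suc j d))
              (ℕP.≤-trans (ℕP.n≤1+n d) (ℕP.≤-trans (ℕP.m≤n+m (suc d) j) (ℕP.n≤1+n _)))))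

twos-then-fans : ∀ j i → PrefixesLarge (suc (j ℕ.+ i)) start (replicate j two ++ adjacentFans (j ℕ.+ i))
twos-then-fans j i = subst (λ b → PrefixesLarge b start (replicate j two ++ adjacentFans (j ℕ.+ i))) (ℕP.+-suc j i)
  (prefixes-++ (replicate j two) (List.length-replicate j)
    (via-first _ (subst (Prefixes≥2 j (+ 1 , + 0)) (sym (List.map-replicate proj₁ j two)) (twos-rising j 0)))
    (subst (λ s → PrefixesLarge (suc i) s (adjacentFans (j ℕ.+ i))) (sym (run₂-twos j)) (fans-after-twos j i)))

replicate-suffix : ∀ {X : Set} m (x : X) P S → replicate m x ≡ P ++ S → ∃[ j ] ∃[ i ] (S ≡ replicate j x × j ℕ.+ i ≡ m)
replicate-suffix m       x []      S e = m , 0 , sym e , ℕP.+-identityʳ m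
replicate-suffix zero    x (_ ∷ P) S ()
replicate-suffix (suc m) x (_ ∷ P) S e with replicate-suffix m x P S (List.∷-injectiveʳ e)
... | j , i , S≡ , j+i≡m = j , suc i , S≡ , trans (ℕP.+-suc j i) (cong suc j+i≡m)

++-≡-++ : ∀ {X : Set} (xs ys P R : List X) → xs ++ ys ≡ P ++ R
        → (∃[ S ] (xs ≡ P ++ S × R ≡ S ++ ys)) ⊎ (∃[ S ] (P ≡ xs ++ S × ys ≡ S ++ R))
++-≡-++ []       ys P       R e = inj₂ (P , refl , e)
++-≡-++ (x ∷ xs) ys []      R e = inj₁ (x ∷ xs , refl , sym e)
++-≡-++ (x ∷ xs) ys (p ∷ P) R e with List.∷-injective e
... | refl , e′ with ++-≡-++ xs ys P R e′
...   | inj₁ (S , xs≡ , R≡) = inj₁ (S , cong (x ∷_) xs≡ , R≡)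
...   | inj₂ (S , P≡ , ys≡) = inj₂ (S , cong (x ∷_) P≡ , ys≡)

-- A cyclic window starts inside the first copy of c.
window-suffix : ∀ {X : Set} (c : List X) {P w Q} → c ++ c ≡ P ++ w ++ Q
              → ∃[ Pre ] ∃[ Suf ] ∃[ R ] (c ≡ Pre ++ Suf × Suf ++ c ≡ w ++ R)
window-suffix c {P} {w} {Q} e with ++-≡-++ c c P (w ++ Q) e
... | inj₁ (S , c≡ , e′) = P , S , Q , c≡ , sym e′
... | inj₂ (S , _ , c≡)  = S , w ++ Q , Q ++ c , c≡ , List.++-assoc w Q c

module AdjacentFanWindows (m : ℕ) where

  after-first : PrefixesLarge (suc m) start (drop 1 (adjacentFans m))
  after-first = via-first _
    (subst (Prefixes≥2 (suc m) (+ 1 , + 0))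
           (cong (λ w → + (2 ℕ.+ m) ∷ + 1 ∷ + 2 ∷ w) (sym (List.map-replicate proj₁ m two)))
           (centre-falling 0 m (suc m) refl (ℕP.n≤1+n m)))

  after-second : PrefixesLarge (suc m) start (drop 2 (adjacentFans m))
  after-second = via-second _
    (subst (Prefixes≥2 (suc m) (+ 1 , + 0))
           (cong (λ w → + (2 ℕ.+ m) ∷ + 1 ∷ w) (sym (List.map-replicate proj₂ m two)))
           (centre-falling 0 m m refl ℕP.≤-refl))

  after-third : PrefixesLarge (suc m) start (drop 3 (adjacentFans m))
  after-third = via-first _
    (subst (Prefixes≥2 (suc m) (+ 1 , + 0)) (cong (+ 2 ∷_) (sym (List.map-replicate proj₁ m two)))
           (twos-rising (suc m) 0))

  budget≤suffix : ∀ k → suc m ℕ.≤ k ℕ.+ suc (length (replicate m two))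
  budget≤suffix k = ℕP.≤-trans (s≤s (ℕP.≤-reflexive (sym (List.length-replicate m)))) (ℕP.m≤n+m _ k)

  suffix-prefixes : ∀ Pre Suf → adjacentFans m ≡ Pre ++ Suf → PrefixesLarge (suc m) start (Suf ++ adjacentFans m)
  suffix-prefixes []                _ refl = prefixes-extend (adjacentFans m) (budget≤suffix 3) (twos-then-fans 0 m)
  suffix-prefixes (_ ∷ [])          _ refl = prefixes-extend (drop 1 (adjacentFans m)) (budget≤suffix 2) after-first
  suffix-prefixes (_ ∷ _ ∷ [])      _ refl = prefixes-extend (drop 2 (adjacentFans m)) (budget≤suffix 1) after-second
  suffix-prefixes (_ ∷ _ ∷ _ ∷ [])  _ refl = prefixes-extend (drop 3 (adjacentFans m)) (budget≤suffix 0) after-third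
  suffix-prefixes (_ ∷ _ ∷ _ ∷ _ ∷ Pre) Suf e
    with replicate-suffix m two Pre Suf (List.∷-injectiveʳ (List.∷-injectiveʳ (List.∷-injectiveʳ (List.∷-injectiveʳ e))))
  ... | j , i , refl , j+i≡m =
    subst (λ n → PrefixesLarge (suc n) start (replicate j two ++ adjacentFans n)) j+i≡m (twos-then-fans j i)

  windows : ShortWindowsLarge (adjacentFans m)
  windows w (P , Q , e) 1≤w (s≤s (s≤s (s≤s w≤))) with window-suffix (adjacentFans m) {P} {w} {Q} e
  ... | Pre , Suf , R , c≡ , Suf++c≡ =
    subst Large (cong heads (run₂-coordinates w _ _))
      (prefixes-at w (subst (PrefixesLarge (suc m) start) Suf++c≡ (suffix-prefixes Pre Suf c≡)) 1≤w
         (subst (length w ℕ.≤_) (cong suc (List.length-replicate m)) w≤))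

triangle : List A
triangle = 1A ∷ 1A ∷ 1A ∷ []

triangle-windows : ShortWindowsLarge triangle
triangle-windows []      _ ()  _
triangle-windows (_ ∷ _) _ _   (s≤s (s≤s (s≤s ())))

mainTheorem5 : (n : ℕ) → n ≥ 3 → ∃[ c ] (IsλQuiddityOfSize n c × Irreducible c)
mainTheorem5 zero                         ()
mainTheorem5 (suc zero)                   (s≤s ())
mainTheorem5 (suc (suc zero))             (s≤s (s≤s ()))
mainTheorem5 (suc (suc (suc zero)))       _ =
  triangle , (refl , inj₂ refl) , inj₂ refl , s≤s (s≤s (s≤s z≤n)) , short-windows⇒¬reducible triangle triangle-windows
mainTheorem5 (suc (suc (suc (suc m)))) _ =
  adjacentFans m , (length-adjacentFans m , quiddity) , quiddity , s≤s (s≤s (s≤s z≤n))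
  , short-windows⇒¬reducible (adjacentFans m) (AdjacentFanWindows.windows m)
  where
  quiddity = inj₂ (adjacentFans-quiddity m)
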